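{- Fix $n$ and $i\in[n]$. Each of the functionals $\deg_i$, $\mathrm{sens}_i$ and $\mathrm{cert}_i$ is a restriction-reducing $i$-coordinate measure.
   Context: All functions are boolean functions $f:\{0,1\}^n\to\{0,1\}$; $x^i$ is $x$ with bit $i$ flipped, and $\delta_i(f)=1$ if $f(x)\ne f(x^i)$ for some $x$, else $0$. For $j\in[n]$ and $b\in\{0,1\}$, $f_{j=b}$ is the function $x\mapsto f(x)$ with $x_j$ set to $b$ (a boolean function on $\{0,1\}^n$ not depending on $x_j$). An $i$-coordinate measure is a functional $m$ on boolean functions with $\delta_i(f)=0\Rightarrow m(f)=0$. It is restriction reducing if for every $f$, every $j\ne i$ and every $b\in\{0,1\}$: (1) $m(f_{j=b})\le m(f)$; (2) if $\delta_i(f)=1$ and $\delta_i(f_{j=b})=0$ then $m(f_{j=1-b})\le m(f)-1$. Definitions: $\deg_i(f):=\deg(f(x)-f(x^i))$, the degree of the multilinear polynomial of $x\mapsto f(x)-f(x^i)$ (degree $0$ for the zero function); $s_x(f)$ is the number of $j$ with $f(x)\ne f(x^j)$; $C_x(f)$ is the smallest size of $S\subseteq[n]$ with $f$ constant on $\{y:y_j=x_j\ \forall j\in S\}$; $\mathrm{sens}_i(f):=\max_{x:f(x)\ne f(x^i)}(s_x(f)+s_{x^i}(f))$ and $\mathrm{cert}_i(f):=\max_{x:f(x)\ne f(x^i)}(C_x(f)+C_{x^i}(f))$, both equal to $0$ when $\delta_i(f)=0$. -}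

module Defs where

open import Data.Bool using (Bool; true; false; not; _∧_; _∨_; _xor_; if_then_else_)
open import Data.Nat as ℕ using (ℕ; zero; suc; _+_; _≤_; _⊔_; _⊓_)
open import Data.Integer as ℤ using (ℤ; 0ℤ; 1ℤ; -1ℤ)
open import Data.Fin using (Fin)
open import Data.Vec using (Vec; []; _∷_; lookup; _[_]%=_; _[_]≔_; zipWith; foldr)
open import Data.List as L using (List; map; filterᵇ; length; concatMap; allFin)
open import Data.Product using (Σ; _×_)
open import Relation.Nullary using (¬_; does)
open import Relation.Binary.PropositionalEquality using (_≡_; _≢_)

Point : ℕ → Set
Point n = Vec Bool n

BF : ℕ → Set
BF n = Point n → Bool

allPoints : (n : ℕ) → List (Point n)
allPoints zero    = [] L.∷ L.[]
allPoints (suc n) = concatMap (λ v → (false ∷ v) L.∷ (true ∷ v) L.∷ L.[]) (allPoints n)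

flipAt : {n : ℕ} → Fin n → Point n → Point n
flipAt i x = x [ i ]%= not

restrict : {n : ℕ} → BF n → Fin n → Bool → BF n
restrict f j b x = f (x [ j ]≔ b)

Depends : {n : ℕ} → Fin n → BF n → Set
Depends i f = Σ (Point _) (λ x → f x ≢ f (flipAt i x))

maxL : List ℕ → ℕ
maxL = L.foldr _⊔_ 0

minL : ℕ → List ℕ → ℕ
minL d = L.foldr _⊓_ d

-- Hamming weight of a point / size of a subset S ⊆ [n] (as characteristic vector)
weight : {n : ℕ} → Point n → ℕ
weight = foldr _ (λ b k → (if b then 1 else 0) + k) 0

subsetᵇ : {n : ℕ} → Point n → Point n → Bool
subsetᵇ T S = foldr _ _∧_ true (zipWith (λ t s → not t ∨ s) T S)

sumℤ : List ℤ → ℤ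
sumℤ = L.foldr ℤ._+_ 0ℤ

boolℤ : Bool → ℤ
boolℤ true  = 1ℤ
boolℤ false = 0ℤ

-- coefficient of the monomial ∏_{j∈S} x_j in the unique multilinear
-- polynomial representing g (Möbius inversion):
--   c_S = Σ_{T ⊆ S} (-1)^{|S|-|T|} g(1_T)
coeff : {n : ℕ} → (Point n → ℤ) → Point n → ℤ
coeff {n} g S =
  sumℤ (map (λ T → (-1ℤ ℤ.^ (weight S ℕ.∸ weight T)) ℤ.* g T)
            (filterᵇ (λ T → subsetᵇ T S) (allPoints n)))

-- degree of the multilinear polynomial of g (0 for the zero function)
degree : {n : ℕ} → (Point n → ℤ) → ℕ
degree {n} g =
  maxL (map weight (filterᵇ (λ S → not (does (coeff g S ℤ.≟ 0ℤ))) (allPoints n)))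

deg-i : {n : ℕ} → Fin n → BF n → ℕ
deg-i i f = degree (λ x → boolℤ (f x) ℤ.- boolℤ (f (flipAt i x)))

sensAt : {n : ℕ} → BF n → Point n → ℕ
sensAt {n} f x = length (filterᵇ (λ j → f x xor f (flipAt j x)) (allFin n))

-- f is constant on {y : y_j = x_j for all j ∈ S}
constOnᵇ : {n : ℕ} → BF n → Point n → Point n → Bool
constOnᵇ {n} f x S =
  L.foldr _∧_ true (map (λ y → not (f y xor f x))
        (filterᵇ (λ y → foldr _ _∧_ true
                          (zipWith (λ s e → not s ∨ e)
                                   S (zipWith (λ a b → not (a xor b)) y x)))
                 (allPoints n)))

-- C_x(f): smallest |S| such that f is constant on the subcube fixing x on S
-- (S = [n] always works, so n is a valid default)
certAt : {n : ℕ} → BF n → Point n → ℕ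
certAt {n} f x = minL n (map weight (filterᵇ (constOnᵇ f x) (allPoints n)))

sens-i : {n : ℕ} → Fin n → BF n → ℕ
sens-i {n} i f =
  maxL (map (λ x → sensAt f x + sensAt f (flipAt i x))
            (filterᵇ (λ x → f x xor f (flipAt i x)) (allPoints n)))

cert-i : {n : ℕ} → Fin n → BF n → ℕ
cert-i {n} i f =
  maxL (map (λ x → certAt f x + certAt f (flipAt i x))
            (filterᵇ (λ x → f x xor f (flipAt i x)) (allPoints n)))

IsCoordMeasure : {n : ℕ} → Fin n → (BF n → ℕ) → Set
IsCoordMeasure i m = ∀ f → ¬ Depends i f → m f ≡ 0

-- restriction reducing (condition (2) written as m(f_{j=1-b}) + 1 ≤ m(f),
-- which is m(f_{j=1-b}) ≤ m(f) - 1 over the integers)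
RestrictionReducing : {n : ℕ} → Fin n → (BF n → ℕ) → Set
RestrictionReducing i m =
  ∀ f j b → j ≢ i →
    (m (restrict f j b) ≤ m f)
    × (Depends i f → ¬ Depends i (restrict f j b) → m (restrict f j (not b)) + 1 ≤ m f)

RestrictionReducingCoordMeasure : {n : ℕ} → Fin n → (BF n → ℕ) → Set
RestrictionReducingCoordMeasure i m = IsCoordMeasure i m × RestrictionReducing i m

{-# OPTIONS --safe #-}
module Submission where

-- Restricting a coordinate j ≠ i can only delete monomials, sensitive coordinates and
-- certificate coordinates, so each measure is monotone under restriction.  For the strict
-- drop, suppose f depends on x_i but f_{j=b} does not.  Then Δ_i f = f(x) − f(x^i)
-- vanishes on {x_j = b}, so each non-zero coefficient c_S of its restriction to x_j = ¬b
-- yields the non-zero coefficient c_{S ∪ {j}} of Δ_i f.  For sens_i and cert_i,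
-- take an i-edge {y, y^i} on which f_{j=¬b} is sensitive: f agrees on y^j and y^{ij} but
-- not on y and y^i, so j is sensitive for f at y or at y^i, and there it is counted in s
-- and lies in every certificate, but it disappears in f_{j=¬b}.

open import Defs

open import Data.Bool as B using (Bool; true; false; not; T; _∧_; _∨_; _xor_)
open import Data.Bool.Properties using (T-∧; ¬-not; not-involutive)
open import Data.Nat as ℕ using (ℕ; zero; suc; _+_; _∸_; _≤_; _<_; _⊔_; _⊓_; z≤n; s≤s)
open import Data.Nat.Properties
open import Data.Integer as ℤ using (ℤ; 0ℤ; -1ℤ)
import Data.Integer.Properties as ℤ
open import Data.Integer.Tactic.RingSolver using (solve-∀)
open import Data.Fin using (Fin; zero; suc)
import Data.Fin.Properties as Fin
open import Data.Vec as V using ([]; _∷_; lookup; _[_]≔_; zipWith; replicate)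
open import Data.Vec.Properties
  using (updateAt-commutes; updateAt-updateAt; []≔-lookup; lookup∘updateAt; lookup∘updateAt′; lookup-replicate)
open import Data.Vec.Relation.Binary.Pointwise.Extensional using (ext; Pointwise-≡⇒≡)
open import Data.List as L using (List; map; filterᵇ; concatMap; length; allFin)
open import Data.List.Properties using (foldr-preservesᵇ; foldr-preservesᵒ; foldr-forcesᵇ)
open import Data.List.Membership.Propositional using (_∈_)
open import Data.List.Membership.Propositional.Properties
  using (∈-map⁺; ∈-map⁻; ∈-filter⁺; ∈-filter⁻; ∈-concatMap⁺; ∈-allFin; foldr-selective)
import Data.List.Relation.Unary.All as All
open import Data.List.Relation.Unary.All.Properties using (all-filter; map⁺; all⁺; all⁻)
open import Data.List.Relation.Unary.Any as Any using (here; there)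
open import Data.Product using (∃; _×_; _,_; proj₁; proj₂)
open import Data.Sum as Sum using (_⊎_; inj₁; inj₂)
open import Data.Empty using (⊥-elim)
open import Function using (_∘_; const; flip; case_of_)
open import Function.Bundles using (Equivalence)
open import Relation.Nullary using (¬_; Dec; yes; no; does)
open import Relation.Nullary.Decidable using (T?; dec-false)
open import Relation.Binary.PropositionalEquality hiding ([_])

<⇒+1≤ : ∀ {m n} → m < n → m + 1 ≤ n
<⇒+1≤ {m} {n} m<n = subst (_≤ n) (+-comm 1 m) m<n

module _ {A : Set} (h : A → ℕ) (p : A → Bool) where

  maxL-filter-≤ : ∀ {M} xs → (∀ {x} → T (p x) → h x ≤ M) → maxL (map h (filterᵇ p xs)) ≤ M
  maxL-filter-≤ {M} xs bound =
    foldr-preservesᵇ {P = _≤ M} {f = _⊔_} ⊔-lub z≤n (map⁺ (All.map bound (all-filter (T? ∘ p) xs)))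

  maxL-filter-< : ∀ {M} xs → 0 < M → (∀ {x} → T (p x) → h x < M) → maxL (map h (filterᵇ p xs)) < M
  maxL-filter-< {M} xs 0<M bound =
    foldr-preservesᵇ {P = _< M} {f = _⊔_} ⊔-lub 0<M (map⁺ (All.map bound (all-filter (T? ∘ p) xs)))

  ≤-maxL-filter : ∀ {x} xs → x ∈ xs → T (p x) → h x ≤ maxL (map h (filterᵇ p xs))
  ≤-maxL-filter xs x∈xs px = All.lookup
    (foldr-forcesᵇ {P = _≤ maxL (map h (filterᵇ p xs))} {f = _⊔_}
      (λ m n m⊔n≤ → m⊔n≤o⇒m≤o m n m⊔n≤ , m⊔n≤o⇒n≤o m n m⊔n≤) _ _ ≤-refl)
    (∈-map⁺ h (∈-filter⁺ (T? ∘ p) x∈xs px))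

  minL-filter-≤ : ∀ d {x} xs → x ∈ xs → T (p x) → minL d (map h (filterᵇ p xs)) ≤ h x
  minL-filter-≤ d {x} xs x∈xs px =
    foldr-preservesᵒ {P = _≤ h x} {f = _⊓_} (λ m n → Sum.[ m≤n⇒m⊓o≤n n , m≤n⇒o⊓m≤n m ]) d _
      (inj₂ (Any.map (λ { refl → ≤-refl }) (∈-map⁺ h (∈-filter⁺ (T? ∘ p) x∈xs px))))

  minL-filter-attained : ∀ d xs → minL d (map h (filterᵇ p xs)) ≡ d
                                 ⊎ ∃ λ x → T (p x) × minL d (map h (filterᵇ p xs)) ≡ h x
  minL-filter-attained d xs with foldr-selective {_•_ = _⊓_} ⊓-sel d (map h (filterᵇ p xs))
  ... | inj₁ ≡d  = inj₁ ≡d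
  ... | inj₂ ∈ys with ∈-map⁻ h ∈ys
  ...   | x , x∈ , ≡hx = inj₂ (x , proj₂ (∈-filter⁻ (T? ∘ p) {xs = xs} x∈) , ≡hx)

module _ {A : Set} {p q : A → Bool} (p⇒q : ∀ {x} → T (p x) → T (q x)) where

  length-filter-mono : ∀ xs → length (filterᵇ p xs) ≤ length (filterᵇ q xs)
  length-filter-mono L.[] = z≤n
  length-filter-mono (x L.∷ xs) with p x in px | q x in qx
  ... | true  | true  = s≤s (length-filter-mono xs)
  ... | true  | false = ⊥-elim (subst T qx (p⇒q (subst T (sym px) _)))
  ... | false | true  = m≤n⇒m≤1+n (length-filter-mono xs)
  ... | false | false = length-filter-mono xs

  length-filter-< : ∀ {x} xs → x ∈ xs → ¬ T (p x) → T (q x) →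
                    length (filterᵇ p xs) < length (filterᵇ q xs)
  length-filter-< (y L.∷ xs) (here refl) ¬px qx with p y | q y
  ... | true  | _     = ⊥-elim (¬px _)
  ... | false | true  = s≤s (length-filter-mono xs)
  length-filter-< (y L.∷ xs) (there x∈xs) ¬px qx with p y in py | q y in qy
  ... | true  | true  = s≤s (length-filter-< xs x∈xs ¬px qx)
  ... | true  | false = ⊥-elim (subst T qy (p⇒q (subst T (sym py) _)))
  ... | false | true  = m≤n⇒m≤1+n (length-filter-< xs x∈xs ¬px qx)
  ... | false | false = length-filter-< xs x∈xs ¬px qx

module _ {A : Set} where

  T-not-does⇒¬ : (a? : Dec A) → T (not (does a?)) → ¬ A
  T-not-does⇒¬ (yes _) ()
  T-not-does⇒¬ (no ¬a) _ = ¬a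

  ¬⇒T-not-does : (a? : Dec A) → ¬ A → T (not (does a?))
  ¬⇒T-not-does a? ¬a = subst (T ∘ not) (sym (dec-false a? ¬a)) _

T-xor⇒≢ : ∀ {a b} → T (a xor b) → a ≢ b
T-xor⇒≢ {true}  {true}  ()
T-xor⇒≢ {false} {false} ()

≢⇒T-xor : ∀ {a b} → a ≢ b → T (a xor b)
≢⇒T-xor {true}  {true}  a≢b = a≢b refl
≢⇒T-xor {true}  {false} _   = _
≢⇒T-xor {false} {true}  _   = _
≢⇒T-xor {false} {false} a≢b = a≢b refl

T-xnor⇒≡ : ∀ {a b} → T (not (a xor b)) → a ≡ b
T-xnor⇒≡ {true}  {true}  _ = refl
T-xnor⇒≡ {false} {false} _ = refl

≡⇒T-xnor : ∀ {a b} → a ≡ b → T (not (a xor b))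
≡⇒T-xnor {true}  refl = _
≡⇒T-xnor {false} refl = _

≢-split : ∀ {a a′ b b′ : Bool} → a ≡ a′ → b ≢ b′ → b ≢ a ⊎ b′ ≢ a′
≢-split {a} {a′} {b} {b′} a≡a′ b≢b′ with b B.≟ a
... | no  b≢a = inj₁ b≢a
... | yes b≡a = inj₂ λ b′≡a′ → b≢b′ (trans b≡a (trans a≡a′ (sym b′≡a′)))

boolℤ-injective : ∀ {a b} → boolℤ a ≡ boolℤ b → a ≡ b
boolℤ-injective {true}  {true}  _ = refl
boolℤ-injective {false} {false} _ = refl

∈-allPoints : ∀ {n} (x : Point n) → x ∈ allPoints n
∈-allPoints []      = here refl
∈-allPoints (b ∷ x) = ∈-concatMap⁺ pair (Any.map (λ { refl → ∈-pair b }) (∈-allPoints x))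
  where
  pair : Point _ → List (Point _)
  pair v = (false ∷ v) L.∷ (true ∷ v) L.∷ L.[]
  ∈-pair : ∀ b → b ∷ x ∈ pair x
  ∈-pair false = here refl
  ∈-pair true  = there (here refl)

module _ {n : ℕ} where

  flipAt-[]≔-comm : ∀ {i j : Fin n} (x : Point n) {c} → i ≢ j →
                    flipAt i (x [ j ]≔ c) ≡ flipAt i x [ j ]≔ c
  flipAt-[]≔-comm {i} {j} x i≢j = updateAt-commutes i j i≢j x

  flipAt-[]≔ : ∀ (j : Fin n) (x : Point n) c → flipAt j (x [ j ]≔ c) ≡ x [ j ]≔ not c
  flipAt-[]≔ j x c = updateAt-updateAt j x

  []≔-flipAt : ∀ (j : Fin n) (x : Point n) c → flipAt j x [ j ]≔ c ≡ x [ j ]≔ c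
  []≔-flipAt j x c = updateAt-updateAt j x

weight-insert : ∀ {n} (S : Point n) j → lookup S j ≡ false → weight (S [ j ]≔ true) ≡ suc (weight S)
weight-insert (false ∷ S) zero    _   = refl
weight-insert (b ∷ S)     (suc j) S∌j =
  trans (cong ((B.if b then 1 else 0) +_) (weight-insert S j S∌j)) (+-suc _ (weight S))

weight-remove : ∀ {n} (S : Point n) j → lookup S j ≡ true → weight S ≡ suc (weight (S [ j ]≔ false))
weight-remove (true ∷ S) zero    _   = refl
weight-remove (b ∷ S)    (suc j) S∋j =
  trans (cong ((B.if b then 1 else 0) +_) (weight-remove S j S∋j)) (+-suc _ _)

weight-[]≔false-≤ : ∀ {n} (S : Point n) j → weight (S [ j ]≔ false) ≤ weight S
weight-[]≔false-≤ S j with lookup S j in S∋j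
... | true  = ≤-trans (n≤1+n _) (≤-reflexive (sym (weight-remove S j S∋j)))
... | false = ≤-reflexive (cong weight (trans (cong (S [ j ]≔_) (sym S∋j)) ([]≔-lookup S j)))

Sensitive : ∀ {n} → BF n → Fin n → Point n → Set
Sensitive f j y = f y ≢ f (flipAt j y)

module _ {n : ℕ} {i : Fin n} where

  ¬Depends⇒invariant : ∀ {f} → ¬ Depends i f → ∀ x → f x ≡ f (flipAt i x)
  ¬Depends⇒invariant {f} ¬dep x with f x B.≟ f (flipAt i x)
  ... | yes fx≡ = fx≡
  ... | no  fx≢ = ⊥-elim (¬dep (x , fx≢))

  restrict-flipAt : ∀ f {j} c x → j ≢ i → restrict f j c (flipAt i x) ≡ f (flipAt i (x [ j ]≔ c))
  restrict-flipAt f c x j≢i = cong f (sym (flipAt-[]≔-comm x (≢-sym j≢i)))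

  Depends-restrict-at : ∀ {f j c x} → j ≢ i → lookup x j ≡ c → Sensitive f i x → Depends i (restrict f j c)
  Depends-restrict-at {f} {j} {x = x} j≢i refl fx≢ = x , λ eq → fx≢ (begin
    f x                                      ≡⟨ cong f ([]≔-lookup x j) ⟨
    restrict f j (lookup x j) x              ≡⟨ eq ⟩
    restrict f j (lookup x j) (flipAt i x)   ≡⟨ restrict-flipAt f _ x j≢i ⟩
    f (flipAt i (x [ j ]≔ lookup x j))       ≡⟨ cong (f ∘ flipAt i) ([]≔-lookup x j) ⟩
    f (flipAt i x)                           ∎)
    where open ≡-Reasoning

  Depends-restrict-not : ∀ {f j} b → j ≢ i → Depends i f → ¬ Depends i (restrict f j b) →
                         Depends i (restrict f j (not b))
  Depends-restrict-not {f} {j} b j≢i (x , fx≢) ¬dep with lookup x j B.≟ b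
  ... | yes xj≡b = ⊥-elim (¬dep (Depends-restrict-at {f} j≢i xj≡b fx≢))
  ... | no  xj≢b = Depends-restrict-at {f} j≢i (¬-not xj≢b) fx≢

-- Möbius inversion one coordinate at a time: c_{S ∪ {0}} = c_S(g(1,·)) − c_S(g(0,·)).
coeffRec : ∀ {n} → (Point n → ℤ) → Point n → ℤ
coeffRec {zero}  g []          = g []
coeffRec {suc n} g (false ∷ S) = coeffRec (g ∘ (false ∷_)) S
coeffRec {suc n} g (true ∷ S)  = coeffRec (g ∘ (true ∷_)) S ℤ.- coeffRec (g ∘ (false ∷_)) S

coeffOver : ∀ {n} → (Point n → ℤ) → Point n → List (Point n) → ℤ
coeffOver g S Ts = sumℤ (map (λ T → (-1ℤ ℤ.^ (weight S ∸ weight T)) ℤ.* g T)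
                             (filterᵇ (λ T → subsetᵇ T S) Ts))

subsetᵇ⇒weight-≤ : ∀ {n} (T S : Point n) → subsetᵇ T S ≡ true → weight T ≤ weight S
subsetᵇ⇒weight-≤ []          []          _  = z≤n
subsetᵇ⇒weight-≤ (false ∷ T) (false ∷ S) T⊆S = subsetᵇ⇒weight-≤ T S T⊆S
subsetᵇ⇒weight-≤ (false ∷ T) (true ∷ S)  T⊆S = m≤n⇒m≤1+n (subsetᵇ⇒weight-≤ T S T⊆S)
subsetᵇ⇒weight-≤ (true ∷ T)  (true ∷ S)  T⊆S = s≤s (subsetᵇ⇒weight-≤ T S T⊆S)

module _ {n} (g : Point (suc n) → ℤ) (S : Point n) where

  private
    pairs : List (Point n) → List (Point (suc n))
    pairs = concatMap (λ v → (false ∷ v) L.∷ (true ∷ v) L.∷ L.[])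

  coeffOver-false : ∀ Ts → coeffOver g (false ∷ S) (pairs Ts) ≡ coeffOver (g ∘ (false ∷_)) S Ts
  coeffOver-false L.[] = refl
  coeffOver-false (T L.∷ Ts) with subsetᵇ T S
  ... | true  = cong (λ rest → (-1ℤ ℤ.^ (weight S ∸ weight T)) ℤ.* g (false ∷ T) ℤ.+ rest)
                     (coeffOver-false Ts)
  ... | false = coeffOver-false Ts

  coeffOver-true : ∀ Ts → coeffOver g (true ∷ S) (pairs Ts)
                        ≡ coeffOver (g ∘ (true ∷_)) S Ts ℤ.- coeffOver (g ∘ (false ∷_)) S Ts
  coeffOver-true L.[] = refl
  coeffOver-true (T L.∷ Ts) with subsetᵇ T S in T⊆S
  ... | false rewrite T⊆S = coeffOver-true Ts
  ... | true  rewrite T⊆S | coeffOver-true Ts | +-∸-assoc 1 (subsetᵇ⇒weight-≤ T S T⊆S) =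
    regroup (-1ℤ ℤ.^ (weight S ∸ weight T)) (g (false ∷ T)) (g (true ∷ T)) _ _
    where
    regroup : ∀ e a b x y → (-1ℤ ℤ.* e) ℤ.* a ℤ.+ (e ℤ.* b ℤ.+ (x ℤ.- y))
                            ≡ (e ℤ.* b ℤ.+ x) ℤ.- (e ℤ.* a ℤ.+ y)
    regroup = solve-∀

coeff≡coeffRec : ∀ {n} (g : Point n → ℤ) S → coeff g S ≡ coeffRec g S
coeff≡coeffRec {zero}  g []          = trans (ℤ.+-identityʳ _) (ℤ.*-identityˡ _)
coeff≡coeffRec {suc n} g (false ∷ S) = trans (coeffOver-false g S (allPoints n)) (coeff≡coeffRec _ S)
coeff≡coeffRec {suc n} g (true ∷ S)  =
  trans (coeffOver-true g S (allPoints n)) (cong₂ ℤ._-_ (coeff≡coeffRec _ S) (coeff≡coeffRec _ S))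

coeffRec-cong : ∀ {n} {g h : Point n → ℤ} → g ≗ h → coeffRec g ≗ coeffRec h
coeffRec-cong {zero}  g≗h []          = g≗h []
coeffRec-cong {suc n} g≗h (false ∷ S) = coeffRec-cong (g≗h ∘ (false ∷_)) S
coeffRec-cong {suc n} g≗h (true ∷ S)  =
  cong₂ ℤ._-_ (coeffRec-cong (g≗h ∘ (true ∷_)) S) (coeffRec-cong (g≗h ∘ (false ∷_)) S)

coeffRec-zero : ∀ {n} {g : Point n → ℤ} → g ≗ const 0ℤ → coeffRec g ≗ const 0ℤ
coeffRec-zero {zero}  g≗0 []          = g≗0 []
coeffRec-zero {suc n} g≗0 (false ∷ S) = coeffRec-zero (g≗0 ∘ (false ∷_)) S
coeffRec-zero {suc n} g≗0 (true ∷ S)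
  rewrite coeffRec-zero (g≗0 ∘ (true ∷_)) S | coeffRec-zero (g≗0 ∘ (false ∷_)) S = refl

coeffRec-nonzero : ∀ {n} (g : Point n → ℤ) x → g x ≢ 0ℤ → ∃ λ S → coeffRec g S ≢ 0ℤ
coeffRec-nonzero {zero}  g []          gx≢0 = [] , gx≢0
coeffRec-nonzero {suc n} g (false ∷ x) gx≢0 with coeffRec-nonzero (g ∘ (false ∷_)) x gx≢0
... | S , c≢0 = false ∷ S , c≢0
coeffRec-nonzero {suc n} g (true ∷ x)  gx≢0 with coeffRec-nonzero (g ∘ (true ∷_)) x gx≢0
... | S , c≢0 with coeffRec (g ∘ (false ∷_)) S ℤ.≟ 0ℤ
...   | no  c′≢0 = false ∷ S , c′≢0
...   | yes c′≡0 = true ∷ S , λ c≡0 → c≢0 (trans (ℤ.i-j≡0⇒i≡j _ _ c≡0) c′≡0)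

coeffRec-restrict-∈ : ∀ {n} (g : Point n → ℤ) j c S → lookup S j ≡ true →
                      coeffRec (λ x → g (x [ j ]≔ c)) S ≡ 0ℤ
coeffRec-restrict-∈ g zero    c (true ∷ S)  _   = ℤ.+-inverseʳ (coeffRec (g ∘ (c ∷_)) S)
coeffRec-restrict-∈ g (suc j) c (false ∷ S) S∋j = coeffRec-restrict-∈ (g ∘ (false ∷_)) j c S S∋j
coeffRec-restrict-∈ g (suc j) c (true ∷ S)  S∋j
  rewrite coeffRec-restrict-∈ (g ∘ (true ∷_)) j c S S∋j
        | coeffRec-restrict-∈ (g ∘ (false ∷_)) j c S S∋j = refl

coeffRec-restrict-false : ∀ {n} (g : Point n → ℤ) j S → lookup S j ≡ false →
                          coeffRec (λ x → g (x [ j ]≔ false)) S ≡ coeffRec g S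
coeffRec-restrict-false g zero    (false ∷ S) _   = refl
coeffRec-restrict-false g (suc j) (false ∷ S) S∌j = coeffRec-restrict-false (g ∘ (false ∷_)) j S S∌j
coeffRec-restrict-false g (suc j) (true ∷ S)  S∌j =
  cong₂ ℤ._-_ (coeffRec-restrict-false (g ∘ (true ∷_)) j S S∌j)
              (coeffRec-restrict-false (g ∘ (false ∷_)) j S S∌j)

coeffRec-insert : ∀ {n} (g : Point n → ℤ) j S → lookup S j ≡ false →
                  coeffRec g (S [ j ]≔ true)
                    ≡ coeffRec (λ x → g (x [ j ]≔ true)) S ℤ.- coeffRec (λ x → g (x [ j ]≔ false)) S
coeffRec-insert g zero    (false ∷ S) _   = refl
coeffRec-insert g (suc j) (false ∷ S) S∌j = coeffRec-insert (g ∘ (false ∷_)) j S S∌j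
coeffRec-insert g (suc j) (true ∷ S)  S∌j =
  trans (cong₂ ℤ._-_ (coeffRec-insert (g ∘ (true ∷_)) j S S∌j)
                     (coeffRec-insert (g ∘ (false ∷_)) j S S∌j))
        (interchange a₁₁ a₁₀ a₀₁ a₀₀)
  where
  a₁₁ a₁₀ a₀₁ a₀₀ : ℤ
  a₁₁ = coeffRec (λ x → g (true ∷ x [ j ]≔ true)) S
  a₁₀ = coeffRec (λ x → g (true ∷ x [ j ]≔ false)) S
  a₀₁ = coeffRec (λ x → g (false ∷ x [ j ]≔ true)) S
  a₀₀ = coeffRec (λ x → g (false ∷ x [ j ]≔ false)) S
  interchange : ∀ a b c d → (a ℤ.- b) ℤ.- (c ℤ.- d) ≡ (a ℤ.- c) ℤ.- (b ℤ.- d)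
  interchange = solve-∀

coeffRec-insert-≢0 : ∀ {n} (g : Point n → ℤ) j S b → lookup S j ≡ false →
                     coeffRec (λ x → g (x [ j ]≔ b)) S ≡ 0ℤ →
                     coeffRec (λ x → g (x [ j ]≔ not b)) S ≢ 0ℤ →
                     coeffRec g (S [ j ]≔ true) ≢ 0ℤ
coeffRec-insert-≢0 g j S false S∌j c₀≡0 c₁≢0 c≡0 =
  c₁≢0 (trans (ℤ.i-j≡0⇒i≡j _ _ (trans (sym (coeffRec-insert g j S S∌j)) c≡0)) c₀≡0)
coeffRec-insert-≢0 g j S true  S∌j c₁≡0 c₀≢0 c≡0 =
  c₀≢0 (trans (sym (ℤ.i-j≡0⇒i≡j _ _ (trans (sym (coeffRec-insert g j S S∌j)) c≡0))) c₁≡0)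

module _ {n : ℕ} (g : Point n → ℤ) where

  weight≤degree : ∀ S → coeffRec g S ≢ 0ℤ → weight S ≤ degree g
  weight≤degree S c≢0 =
    ≤-maxL-filter weight _ (allPoints n) (∈-allPoints S)
      (¬⇒T-not-does (coeff g S ℤ.≟ 0ℤ) (c≢0 ∘ trans (sym (coeff≡coeffRec g S))))

  degree-≤ : ∀ {d} → (∀ S → coeffRec g S ≢ 0ℤ → weight S ≤ d) → degree g ≤ d
  degree-≤ bound = maxL-filter-≤ weight _ (allPoints n)
    (λ {S} c≢0 → bound S (T-not-does⇒¬ (coeff g S ℤ.≟ 0ℤ) c≢0 ∘ trans (coeff≡coeffRec g S)))

  degree-< : ∀ {d} → 0 < d → (∀ S → coeffRec g S ≢ 0ℤ → weight S < d) → degree g < d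
  degree-< 0<d bound = maxL-filter-< weight _ (allPoints n) 0<d
    (λ {S} c≢0 → bound S (T-not-does⇒¬ (coeff g S ℤ.≟ 0ℤ) c≢0 ∘ trans (coeff≡coeffRec g S)))

degree-cong : ∀ {n} {g h : Point n → ℤ} → g ≗ h → degree g ≡ degree h
degree-cong {g = g} {h} g≗h = ≤-antisym
  (degree-≤ g λ S c≢0 → weight≤degree h S (c≢0 ∘ trans (coeffRec-cong g≗h S)))
  (degree-≤ h λ S c≢0 → weight≤degree g S (c≢0 ∘ trans (sym (coeffRec-cong g≗h S))))

degree-zero : ∀ {n} {g : Point n → ℤ} → g ≗ const 0ℤ → degree g ≡ 0
degree-zero {g = g} g≗0 = n≤0⇒n≡0 (degree-≤ g λ S c≢0 → ⊥-elim (c≢0 (coeffRec-zero g≗0 S)))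

module _ {n : ℕ} (g : Point n → ℤ) (j : Fin n) where

  degree-restrict-≤ : ∀ c → degree (λ x → g (x [ j ]≔ c)) ≤ degree g
  degree-restrict-≤ c = degree-≤ _ (bound c)
    where
    bound : ∀ c S → coeffRec (λ x → g (x [ j ]≔ c)) S ≢ 0ℤ → weight S ≤ degree g
    bound c S c≢0 with lookup S j in S∋j
    bound c     S c≢0 | true  = ⊥-elim (c≢0 (coeffRec-restrict-∈ g j c S S∋j))
    bound false S c≢0 | false = weight≤degree g S (c≢0 ∘ trans (coeffRec-restrict-false g j S S∋j))
    bound true  S c≢0 | false with coeffRec g S ℤ.≟ 0ℤ
    ...   | no  c′≢0 = weight≤degree g S c′≢0
    ...   | yes c′≡0 = ≤-trans (n≤1+n _) (subst (_≤ degree g) (weight-insert S j S∋j)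
                         (weight≤degree g _ (coeffRec-insert-≢0 g j S false S∋j
                           (trans (coeffRec-restrict-false g j S S∋j) c′≡0) c≢0)))

  degree-restrict-< : ∀ b → (λ x → g (x [ j ]≔ b)) ≗ const 0ℤ → ∀ x → g (x [ j ]≔ not b) ≢ 0ℤ →
                      degree (λ x → g (x [ j ]≔ not b)) < degree g
  degree-restrict-< b g₀≗0 x g₁x≢0 = degree-< _ (≤-<-trans z≤n (bound S₀ c₀≢0)) bound
    where
    bound : ∀ S → coeffRec (λ x → g (x [ j ]≔ not b)) S ≢ 0ℤ → weight S < degree g
    bound S c≢0 with lookup S j in S∋j
    ... | true  = ⊥-elim (c≢0 (coeffRec-restrict-∈ g j (not b) S S∋j))
    ... | false = subst (_≤ degree g) (weight-insert S j S∋j)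
                    (weight≤degree g _ (coeffRec-insert-≢0 g j S b S∋j (coeffRec-zero g₀≗0 S) c≢0))
    S₀ = proj₁ (coeffRec-nonzero _ x g₁x≢0)
    c₀≢0 = proj₂ (coeffRec-nonzero _ x g₁x≢0)

Δ : ∀ {n} → Fin n → BF n → Point n → ℤ
Δ i f x = boolℤ (f x) ℤ.- boolℤ (f (flipAt i x))

module _ {n : ℕ} {i : Fin n} where

  Δ≡0 : ∀ {f x} → f x ≡ f (flipAt i x) → Δ i f x ≡ 0ℤ
  Δ≡0 {f} {x} fx≡ = ℤ.i≡j⇒i-j≡0 (cong boolℤ fx≡)

  Δ≢0 : ∀ {f x} → Sensitive f i x → Δ i f x ≢ 0ℤ
  Δ≢0 fx≢ = fx≢ ∘ boolℤ-injective ∘ ℤ.i-j≡0⇒i≡j _ _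

  Δ-restrict : ∀ f {j} c → j ≢ i → Δ i (restrict f j c) ≗ λ x → Δ i f (x [ j ]≔ c)
  Δ-restrict f c j≢i x = cong (λ y → boolℤ (restrict f _ c x) ℤ.- boolℤ y) (restrict-flipAt f c x j≢i)

  deg-i-measure : RestrictionReducingCoordMeasure i (deg-i i)
  deg-i-measure = (λ f ¬dep → degree-zero (Δ≡0 {f} ∘ ¬Depends⇒invariant ¬dep)) , reducing
    where
    reducing : RestrictionReducing i (deg-i i)
    reducing f j b j≢i = restrict-≤ , restrict-<
      where
      restrict-≡ : ∀ c → deg-i i (restrict f j c) ≡ degree (λ x → Δ i f (x [ j ]≔ c))
      restrict-≡ c = degree-cong (Δ-restrict f c j≢i)
      restrict-≤ : deg-i i (restrict f j b) ≤ deg-i i f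
      restrict-≤ = ≤-trans (≤-reflexive (restrict-≡ b)) (degree-restrict-≤ (Δ i f) j b)
      restrict-< : Depends i f → ¬ Depends i (restrict f j b) →
                   deg-i i (restrict f j (not b)) + 1 ≤ deg-i i f
      restrict-< dep ¬dep with Depends-restrict-not b j≢i dep ¬dep
      ... | x , fx≢ = <⇒+1≤ (subst (_< deg-i i f) (sym (restrict-≡ (not b)))
            (degree-restrict-< (Δ i f) j b
              (λ y → trans (sym (Δ-restrict f b j≢i y)) (Δ≡0 {restrict f j b} (¬Depends⇒invariant ¬dep y)))
              x (Δ≢0 {restrict f j (not b)} fx≢ ∘ trans (Δ-restrict f (not b) j≢i x))))

module _ {n : ℕ} (i : Fin n) (loc : BF n → Point n → ℕ) where

  -- sens-i i and cert-i i are edgeMax i sensAt and edgeMax i certAt by definition.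
  edgeMax : BF n → ℕ
  edgeMax f = maxL (map (λ x → loc f x + loc f (flipAt i x))
                        (filterᵇ (λ x → f x xor f (flipAt i x)) (allPoints n)))

  edgeMax-measure :
    (∀ f j c x → loc (restrict f j c) x ≤ loc f (x [ j ]≔ c)) →
    (∀ f j c x → Sensitive f j (x [ j ]≔ c) → loc (restrict f j c) x < loc f (x [ j ]≔ c)) →
    RestrictionReducingCoordMeasure i edgeMax
  edgeMax-measure loc-restrict-≤ loc-restrict-< = coord , reducing
    where
    coord : IsCoordMeasure i edgeMax
    coord f ¬dep = n≤0⇒n≡0 (maxL-filter-≤ _ _ (allPoints n)
      λ {x} edge → ⊥-elim (T-xor⇒≢ edge (¬Depends⇒invariant ¬dep x)))

    reducing : RestrictionReducing i edgeMax
    reducing f j b j≢i = restrict-≤ , restrict-<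
      where
      flip-[]≔ : ∀ c x → flipAt i x [ j ]≔ c ≡ flipAt i (x [ j ]≔ c)
      flip-[]≔ c x = sym (flipAt-[]≔-comm x (≢-sym j≢i))

      edge-restrict : ∀ c x → T (restrict f j c x xor restrict f j c (flipAt i x)) →
                      T (f (x [ j ]≔ c) xor f (flipAt i (x [ j ]≔ c)))
      edge-restrict c x = subst (λ z → T (f (x [ j ]≔ c) xor f z)) (flip-[]≔ c x)

      ≤-edgeMax : ∀ y → T (f y xor f (flipAt i y)) → loc f y + loc f (flipAt i y) ≤ edgeMax f
      ≤-edgeMax y = ≤-maxL-filter _ _ (allPoints n) (∈-allPoints y)

      loc-flip-≤ : ∀ c x → loc (restrict f j c) (flipAt i x) ≤ loc f (flipAt i (x [ j ]≔ c))
      loc-flip-≤ c x = subst (loc (restrict f j c) (flipAt i x) ≤_) (cong (loc f) (flip-[]≔ c x))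
                             (loc-restrict-≤ f j c (flipAt i x))

      loc-flip-< : ∀ c x → Sensitive f j (flipAt i x [ j ]≔ c) →
                   loc (restrict f j c) (flipAt i x) < loc f (flipAt i (x [ j ]≔ c))
      loc-flip-< c x sens = subst (loc (restrict f j c) (flipAt i x) <_) (cong (loc f) (flip-[]≔ c x))
                                  (loc-restrict-< f j c (flipAt i x) sens)

      restrict-≤ : edgeMax (restrict f j b) ≤ edgeMax f
      restrict-≤ = maxL-filter-≤ _ _ (allPoints n) λ {x} edge →
        ≤-trans (+-mono-≤ (loc-restrict-≤ f j b x) (loc-flip-≤ b x)) (≤-edgeMax _ (edge-restrict b x edge))

      flipAt-j : ∀ z → f (flipAt j (z [ j ]≔ not b)) ≡ f (z [ j ]≔ b)
      flipAt-j z = cong f (trans (flipAt-[]≔ j z (not b)) (cong (z [ j ]≔_) (not-involutive b)))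

      edge-< : ¬ Depends i (restrict f j b) →
               ∀ {x} → T (restrict f j (not b) x xor restrict f j (not b) (flipAt i x)) →
               loc (restrict f j (not b)) x + loc (restrict f j (not b)) (flipAt i x) < edgeMax f
      edge-< ¬dep {x} edge with ≢-split (¬Depends⇒invariant ¬dep x) (T-xor⇒≢ edge)
      ... | inj₁ sens = <-≤-trans
        (+-mono-<-≤ (loc-restrict-< f j (not b) x (sens ∘ flip trans (flipAt-j x))) (loc-flip-≤ (not b) x))
        (≤-edgeMax _ (edge-restrict (not b) x edge))
      ... | inj₂ sens = <-≤-trans
        (+-mono-≤-< (loc-restrict-≤ f j (not b) x) (loc-flip-< (not b) x (sens ∘ flip trans (flipAt-j (flipAt i x)))))
        (≤-edgeMax _ (edge-restrict (not b) x edge))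

      restrict-< : Depends i f → ¬ Depends i (restrict f j b) →
                   edgeMax (restrict f j (not b)) + 1 ≤ edgeMax f
      restrict-< dep ¬dep with Depends-restrict-not b j≢i dep ¬dep
      ... | x , fx≢ =
        <⇒+1≤ (maxL-filter-< _ _ (allPoints n) (≤-<-trans z≤n (edge-< ¬dep (≢⇒T-xor fx≢))) (edge-< ¬dep))

module _ {n : ℕ} (f : BF n) (j : Fin n) (c : Bool) (x : Point n) where

  private
    sensitive-restrict : ∀ {k} → T (restrict f j c x xor restrict f j c (flipAt k x)) →
                         T (f (x [ j ]≔ c) xor f (flipAt k (x [ j ]≔ c)))
    sensitive-restrict {k} sens with k Fin.≟ j
    ... | yes refl = ⊥-elim (T-xor⇒≢ sens (cong f (sym ([]≔-flipAt j x c))))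
    ... | no  k≢j  = subst (λ z → T (f (x [ j ]≔ c) xor f z)) (sym (flipAt-[]≔-comm x k≢j)) sens

  sensAt-restrict-≤ : sensAt (restrict f j c) x ≤ sensAt f (x [ j ]≔ c)
  sensAt-restrict-≤ = length-filter-mono sensitive-restrict (allFin n)

  sensAt-restrict-< : Sensitive f j (x [ j ]≔ c) → sensAt (restrict f j c) x < sensAt f (x [ j ]≔ c)
  sensAt-restrict-< sens = length-filter-< sensitive-restrict _ (∈-allFin j)
    (λ sens′ → T-xor⇒≢ sens′ (cong f (sym ([]≔-flipAt j x c)))) (≢⇒T-xor sens)

AgreeOn : ∀ {n} → Point n → Point n → Point n → Set
AgreeOn S y x = ∀ k → lookup S k ≡ true → lookup y k ≡ lookup x k

-- The subcube test inside constOnᵇ.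
agreeᵇ : ∀ {n} → Point n → Point n → Point n → Bool
agreeᵇ S y x =
  V.foldr _ _∧_ true (zipWith (λ s e → not s ∨ e) S (zipWith (λ a b → not (a xor b)) y x))

agreeᵇ-sound : ∀ {n} (S y x : Point n) → T (agreeᵇ S y x) → AgreeOn S y x
agreeᵇ-sound (false ∷ S) (a ∷ y) (b ∷ x) agree (suc k) Sk = agreeᵇ-sound S y x agree k Sk
agreeᵇ-sound (true ∷ S)  (a ∷ y) (b ∷ x) agree zero    _  = T-xnor⇒≡ (proj₁ (Equivalence.to T-∧ agree))
agreeᵇ-sound (true ∷ S)  (a ∷ y) (b ∷ x) agree (suc k) Sk =
  agreeᵇ-sound S y x (proj₂ (Equivalence.to (T-∧ {not (a xor b)}) agree)) k Sk

agreeᵇ-complete : ∀ {n} (S y x : Point n) → AgreeOn S y x → T (agreeᵇ S y x)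
agreeᵇ-complete []          []      []      _     = _
agreeᵇ-complete (false ∷ S) (a ∷ y) (b ∷ x) agree = agreeᵇ-complete S y x (agree ∘ suc)
agreeᵇ-complete (true ∷ S)  (a ∷ y) (b ∷ x) agree =
  Equivalence.from T-∧ (≡⇒T-xnor (agree zero refl) , agreeᵇ-complete S y x (agree ∘ suc))

module _ {n : ℕ} (f : BF n) (x : Point n) where

  IsCertificate : Point n → Set
  IsCertificate S = ∀ y → AgreeOn S y x → f y ≡ f x

  constOnᵇ-sound : ∀ S → T (constOnᵇ f x S) → IsCertificate S
  constOnᵇ-sound S const y agree = T-xnor⇒≡ (All.lookup (all⁺ _ _ const)
    (∈-filter⁺ (T? ∘ λ y → agreeᵇ S y x) (∈-allPoints y) (agreeᵇ-complete S y x agree)))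

  constOnᵇ-complete : ∀ S → IsCertificate S → T (constOnᵇ f x S)
  constOnᵇ-complete S cert = all⁻ _ (All.tabulate λ y∈ →
    ≡⇒T-xnor (cert _ (agreeᵇ-sound S _ x
      (proj₂ (∈-filter⁻ (T? ∘ λ y → agreeᵇ S y x) {xs = allPoints n} y∈)))))

  certAt-≤ : ∀ S → IsCertificate S → certAt f x ≤ weight S
  certAt-≤ S cert =
    minL-filter-≤ weight (constOnᵇ f x) n (allPoints n) (∈-allPoints S) (constOnᵇ-complete S cert)

  certAt-attained : ∃ λ S → IsCertificate S × certAt f x ≡ weight S
  certAt-attained with minL-filter-attained weight (constOnᵇ f x) n (allPoints n)
  ... | inj₁ ≡n               = replicate n true , whole , trans ≡n (sym (weight-replicate n))
    where
    whole : IsCertificate (replicate n true)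
    whole y agree = cong f (Pointwise-≡⇒≡ (ext λ k → agree k (lookup-replicate k true)))
    weight-replicate : ∀ m → weight (replicate m true) ≡ m
    weight-replicate zero    = refl
    weight-replicate (suc m) = cong suc (weight-replicate m)
  ... | inj₂ (S , const , ≡w) = S , constOnᵇ-sound S const , ≡w

  certificate-∋ : ∀ {S k} → IsCertificate S → Sensitive f k x → lookup S k ≡ true
  certificate-∋ {S} {k} cert fx≢ with lookup S k in Sk
  ... | true  = refl
  ... | false = ⊥-elim (fx≢ (sym (cert (flipAt k x) agree)))
    where
    agree : AgreeOn S (flipAt k x) x
    agree m S∋m = lookup∘updateAt′ m k (λ { refl → case trans (sym S∋m) Sk of λ () }) x

module _ {n : ℕ} (f : BF n) (j : Fin n) (c : Bool) (x : Point n) where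

  certificate-restrict : ∀ {S} → IsCertificate f (x [ j ]≔ c) S →
                         IsCertificate (restrict f j c) x (S [ j ]≔ false)
  certificate-restrict {S} cert z agree = cert (z [ j ]≔ c) agree′
    where
    agree′ : AgreeOn S (z [ j ]≔ c) (x [ j ]≔ c)
    agree′ k Sk with k Fin.≟ j
    ... | yes refl = trans (lookup∘updateAt j z) (sym (lookup∘updateAt j x))
    ... | no  k≢j  = begin
      lookup (z [ j ]≔ c) k  ≡⟨ lookup∘updateAt′ k j k≢j z ⟩
      lookup z k             ≡⟨ agree k (trans (lookup∘updateAt′ k j k≢j S) Sk) ⟩
      lookup x k             ≡⟨ lookup∘updateAt′ k j k≢j x ⟨
      lookup (x [ j ]≔ c) k  ∎
      where open ≡-Reasoning

  certAt-restrict-≤ : certAt (restrict f j c) x ≤ certAt f (x [ j ]≔ c)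
  certAt-restrict-≤ with certAt-attained f (x [ j ]≔ c)
  ... | S , cert , ≡w = ≤-trans (certAt-≤ _ x (S [ j ]≔ false) (certificate-restrict {S} cert))
                          (≤-trans (weight-[]≔false-≤ S j) (≤-reflexive (sym ≡w)))

  certAt-restrict-< : Sensitive f j (x [ j ]≔ c) → certAt (restrict f j c) x < certAt f (x [ j ]≔ c)
  certAt-restrict-< sens with certAt-attained f (x [ j ]≔ c)
  ... | S , cert , ≡w = ≤-trans (s≤s (certAt-≤ _ x (S [ j ]≔ false) (certificate-restrict {S} cert)))
                          (≤-reflexive (trans (sym (weight-remove S j S∋j)) (sym ≡w)))
    where
    S∋j = certificate-∋ f _ {S} cert sens

lemma1 : (n : ℕ) (i : Fin n) →
    RestrictionReducingCoordMeasure i (deg-i i)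
    × RestrictionReducingCoordMeasure i (sens-i i)
    × RestrictionReducingCoordMeasure i (cert-i i)
lemma1 n i =
  deg-i-measure ,
  edgeMax-measure i sensAt sensAt-restrict-≤ sensAt-restrict-< ,
  edgeMax-measure i certAt certAt-restrict-≤ certAt-restrict-<
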